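{- Let $G$ be a graph, $H$ a handle of $G$ and $J$ a co-handle of $H$. Then $J$ is an interesting set of the complement $\overline{G}$.
   Context: All graphs are finite and simple. For $X\subseteq V$, $N(X)$ is the set of vertices of $V\setminus X$ with a neighbour in $X$, and $C(X)$ is the set of vertices of $V\setminus X$ adjacent to all of $X$ (computed in the graph under consideration). A non-empty set $T$ is interesting in a graph $F$ if the complement of $F[T]$ is connected and $F[C(T)]$ is not a clique. A handle in $G=(V,E)$ is a subset $H\subset V$ with $|H|\ge 2$ such that $G[H]$ is connected, some connected component $J\neq H$ of $G\setminus N(H)$ satisfies $N(J)=N(H)$, and each vertex of $N(H)$ is adjacent to at least one endpoint of each edge of $G[H]$; any such $J$ is a co-handle of $H$. -}

module Defs where

open import Data.Nat using (ℕ; _≥_)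
open import Data.Fin using (Fin)
open import Data.Fin.Subset using (Subset; _∈_; _∉_; _⊆_; _⊂_; ⊤; ∣_∣; Nonempty)
open import Data.Product using (_×_; ∃; _,_)
open import Data.Sum using (_⊎_)
open import Relation.Nullary using (¬_; Dec)
open import Relation.Binary.PropositionalEquality using (_≡_; _≢_)
open import Relation.Binary.Definitions using (Decidable; Symmetric)

record Graph (n : ℕ) : Set₁ where
  field
    Adj    : Fin n → Fin n → Set
    sym    : Symmetric Adj
    irrefl : ∀ v → ¬ Adj v v
    adj?   : Decidable Adj
open Graph public

complement : ∀ {n} → Graph n → Graph n
complement {n} G = record
  { Adj = λ u v → u ≢ v × ¬ Adj G u v
  ; sym = λ { (u≢v , ¬a) → (λ e → u≢v (Relation.Binary.PropositionalEquality.sym e)) , (λ a → ¬a (Graph.sym G a)) }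
  ; irrefl = λ { v (v≢v , _) → v≢v Relation.Binary.PropositionalEquality.refl }
  ; adj? = dec
  }
  where
  open import Data.Fin.Properties using (_≟_)
  open import Relation.Nullary using (yes; no)
  dec : Decidable (λ u v → u ≢ v × ¬ Adj G u v)
  dec u v with u ≟ v | adj? G u v
  ... | yes e | _     = no λ { (u≢v , _) → u≢v e }
  ... | no ne | yes a = no λ { (_ , ¬a) → ¬a a }
  ... | no ne | no ¬a = yes (ne , ¬a)

data PathIn {n} (G : Graph n) (S : Subset n) : Fin n → Fin n → Set where
  here  : ∀ {x} → x ∈ S → PathIn G S x x
  there : ∀ {x y z} → x ∈ S → Adj G x y → PathIn G S y z → PathIn G S x z

-- G[S] is connected (every two vertices of S are joined by a walk in G[S]).
-- Non-emptiness is imposed separately where needed.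
Connected : ∀ {n} → Graph n → Subset n → Set
Connected G S = ∀ x y → x ∈ S → y ∈ S → PathIn G S x y

InN : ∀ {n} → Graph n → Subset n → Fin n → Set
InN G X v = v ∉ X × ∃ λ u → u ∈ X × Adj G u v

InC : ∀ {n} → Graph n → Subset n → Fin n → Set
InC G X v = v ∉ X × (∀ u → u ∈ X → Adj G u v)

IsComponentOutsideN : ∀ {n} → Graph n → Subset n → Subset n → Set
IsComponentOutsideN {n} G H J =
  (∀ v → v ∈ J → ¬ InN G H v) ×
  Nonempty J ×
  Connected G J ×
  (∀ (S : Subset n) → J ⊆ S → (∀ v → v ∈ S → ¬ InN G H v) → Connected G S → S ⊆ J)

IsCoHandle : ∀ {n} → Graph n → Subset n → Subset n → Set
IsCoHandle G H J =
  IsComponentOutsideN G H J ×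
  J ≢ H ×
  (∀ v → InN G J v → InN G H v) × (∀ v → InN G H v → InN G J v)

IsHandleWithCoHandle : ∀ {n} → Graph n → Subset n → Subset n → Set
IsHandleWithCoHandle G H J =
  H ⊂ ⊤ ×
  ∣ H ∣ ≥ 2 ×
  Connected G H ×
  IsCoHandle G H J ×
  (∀ v x y → InN G H v → x ∈ H → y ∈ H → Adj G x y → Adj G v x ⊎ Adj G v y)

IsClique : ∀ {n} → Graph n → (Fin n → Set) → Set
IsClique F P = ∀ u v → P u → P v → u ≢ v → Adj F u v

-- T is interesting in F: T non-empty, complement of F[T] connected,
-- F[C(T)] not a clique.  (complement of F[T]) = (complement F)[T].
Interesting : ∀ {n} → Graph n → Subset n → Set
Interesting F T =
  Nonempty T × Connected (complement F) T × ¬ IsClique F (InC F T)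

{-# OPTIONS --safe #-}
-- H and J are disjoint: a common vertex would give J ⊆ H, since J is connected
-- and avoids N(H), and H ⊆ J, since H is connected and avoids N(J) ⊆ N(H).
-- Hence no vertex of H has a G-neighbour in J, i.e. H ⊆ C(J) in the complement
-- of G, and an edge of G[H] (which exists, as H is connected with at least two
-- vertices) is a non-edge of the complement inside C(J). Connectivity of the
-- complement of (complement G)[J] is just connectivity of G[J].
module Submission where

open import Defs
open import Data.Nat using (ℕ; _≤_; s≤s; z≤n)
open import Data.Nat.Properties using (≤-trans)
open import Data.Fin using (Fin)
open import Data.Fin.Properties using (_≟_; any?)
open import Data.Fin.Subset using (Subset; _∈_; _∉_; _⊆_; ⁅_⁆; ∣_∣; Nonempty; Empty)
open import Data.Fin.Subset.Properties
  using (_∈?_; nonempty?; Empty-unique; ∣⊥∣≡0; ∣⁅x⁆∣≡1; x∈⁅x⁆; p⊆q⇒∣p∣≤∣q∣; ⊆-antisym)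
open import Data.Product using (_×_; _,_; ∃; ∃₂; proj₁; proj₂)
open import Relation.Nullary using (¬_; yes; no; contradiction)
open import Relation.Nullary.Decidable using (_×-dec_; ¬?)
open import Relation.Binary.PropositionalEquality as ≡ using (_≡_; _≢_; refl; cong; subst)

private
  variable
    n : ℕ
    H J S T : Subset n
    x y : Fin n

Empty⇒∣p∣≡0 : Empty S → ∣ S ∣ ≡ 0
Empty⇒∣p∣≡0 {n} e = ≡.trans (cong ∣_∣ (Empty-unique e)) (∣⊥∣≡0 n)

1≤∣p∣⇒Nonempty : 1 ≤ ∣ S ∣ → Nonempty S
1≤∣p∣⇒Nonempty {S = S} 1≤∣S∣ with nonempty? S
... | yes ne = ne
... | no ¬ne with () ← subst (1 ≤_) (Empty⇒∣p∣≡0 ¬ne) 1≤∣S∣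

¬∃-other⇒⊆⁅x⁆ : ¬ (∃ λ y → y ∈ S × y ≢ x) → S ⊆ ⁅ x ⁆
¬∃-other⇒⊆⁅x⁆ {x = x} ∄y {y} y∈S with y ≟ x
... | yes refl = x∈⁅x⁆ x
... | no y≢x   = contradiction (y , y∈S , y≢x) ∄y

2≤∣p∣⇒∃-distinct : 2 ≤ ∣ S ∣ → ∃₂ λ x y → x ∈ S × y ∈ S × x ≢ y
2≤∣p∣⇒∃-distinct {S = S} 2≤∣S∣
  with x , x∈S ← 1≤∣p∣⇒Nonempty (≤-trans (s≤s z≤n) 2≤∣S∣)
  with any? (λ y → (y ∈? S) ×-dec ¬? (y ≟ x))
... | yes (y , y∈S , y≢x) = x , y , x∈S , y∈S , λ x≡y → y≢x (≡.sym x≡y)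
... | no ∄y with s≤s () ← ≤-trans 2≤∣S∣
      (subst (∣ S ∣ ≤_) (∣⁅x⁆∣≡1 x) (p⊆q⇒∣p∣≤∣q∣ (¬∃-other⇒⊆⁅x⁆ ∄y)))

PathIn-map : ∀ {G G′ : Graph n} → (∀ {u v} → Adj G u v → Adj G′ u v) →
             PathIn G S x y → PathIn G′ S x y
PathIn-map f (here x∈S)        = here x∈S
PathIn-map f (there x∈S uv p) = there x∈S (f uv) (PathIn-map f p)

module _ (G : Graph n) where

  PathIn-head : PathIn G S x y → x ∈ S
  PathIn-head (here x∈S)       = x∈S
  PathIn-head (there x∈S _ _) = x∈S

  PathIn-stays : (∀ v → v ∈ S → ¬ InN G T v) → PathIn G S x y → x ∈ T → y ∈ T
  PathIn-stays noN (here _) x∈T = x∈T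
  PathIn-stays {T = T} noN (there {y = z} _ xz p) x∈T with z ∈? T
  ... | yes z∈T = PathIn-stays noN p z∈T
  ... | no  z∉T = contradiction (z∉T , _ , x∈T , xz) (noN z (PathIn-head p))

  Connected⇒⊆ : Connected G S → (∀ v → v ∈ S → ¬ InN G T v) → x ∈ S → x ∈ T → S ⊆ T
  Connected⇒⊆ conS noN x∈S x∈T y∈S = PathIn-stays noN (conS _ _ x∈S y∈S) x∈T

  PathIn⇒first-edge : PathIn G S x y → x ≢ y → ∃ λ z → z ∈ S × Adj G x z
  PathIn⇒first-edge (here _)         x≢x = contradiction refl x≢x
  PathIn⇒first-edge (there _ xz p) _   = _ , PathIn-head p , xz

  Adj⇒Adj-complement² : Adj G x y → Adj (complement (complement G)) x y
  Adj⇒Adj-complement² {x} xy =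
    (λ { refl → irrefl G x xy }) , λ (_ , ¬xy) → ¬xy xy

  Connected-complement² : Connected G S → Connected (complement (complement G)) S
  Connected-complement² conS x y x∈S y∈S = PathIn-map Adj⇒Adj-complement² (conS x y x∈S y∈S)

  ∉N⇒InC-complement : x ∉ S → ¬ InN G S x → InC (complement G) S x
  ∉N⇒InC-complement x∉S x∉N =
    x∉S , λ u u∈S → (λ { refl → x∉S u∈S }) , λ ux → x∉N (x∉S , u , u∈S , ux)

  Adj⇒¬IsClique-complement : ∀ {P : Fin n → Set} → P x → P y → Adj G x y →
                              ¬ IsClique (complement G) P
  Adj⇒¬IsClique-complement {x} Px Py xy clique =
    proj₂ (clique _ _ Px Py λ { refl → irrefl G x xy }) xy

  coHandle-disjoint : Connected G H → IsCoHandle G H J → x ∈ H → x ∉ J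
  coHandle-disjoint conH ((outN , _ , conJ , _) , J≢H , NJ⊆NH , _) x∈H x∈J =
    J≢H (⊆-antisym (Connected⇒⊆ conJ outN x∈J x∈H) (Connected⇒⊆ conH noNJ x∈H x∈J))
    where noNJ = λ v v∈H v∈NJ → proj₁ (NJ⊆NH v v∈NJ) v∈H

  handle⊆InC-complement : Connected G H → IsCoHandle G H J → x ∈ H → InC (complement G) J x
  handle⊆InC-complement conH coH@(_ , _ , NJ⊆NH , _) x∈H =
    ∉N⇒InC-complement (coHandle-disjoint conH coH x∈H) λ x∈NJ → proj₁ (NJ⊆NH _ x∈NJ) x∈H

lemma15 : ∀ {n : ℕ} (G : Graph n) (H J : Subset n) →
    IsHandleWithCoHandle G H J → Interesting (complement G) J
lemma15 G H J (_ , 2≤∣H∣ , conH , coH@((_ , neJ , conJ , _) , _) , _)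
  with a , b , a∈H , b∈H , a≢b ← 2≤∣p∣⇒∃-distinct 2≤∣H∣
  with c , c∈H , ac ← PathIn⇒first-edge G (conH a b a∈H b∈H) a≢b
  = neJ
  , Connected-complement² G conJ
  , Adj⇒¬IsClique-complement G (H⊆C a∈H) (H⊆C c∈H) ac
  where
  H⊆C : ∀ {x} → x ∈ H → InC (complement G) J x
  H⊆C = handle⊆InC-complement G conH coH
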